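{- Let $q$ be a prime power, $k\ge0$, and fix $b\in\mathcal M(k)$. Then the number of $a\in\mathcal M(k)$ satisfying $a^*a=b^*b$ is at most $\tau(b)$, the number of monic divisors of $b$ in $\mathbb F_q[t]$.
   Context: $\mathcal M(k)$ is the set of monic polynomials of degree $k$ in $\mathbb F_q[t]$. For a polynomial $a$ of degree $k$, $a^*(t)=t^ka(t^{ -1})$ denotes its reciprocal polynomial. -}

module Defs where

open import Level using (Level; _⊔_; suc)
open import Data.Nat using (ℕ)
open import Data.List using (List; []; _∷_; map; reverse; _++_; [_])
open import Data.List.Relation.Unary.Any using (Any)
open import Data.Vec using (Vec; toList)
open import Data.Product using (Σ; ∃; _,_; proj₁; proj₂)
open import Relation.Nullary using (¬_)
open import Algebra.Bundles using (CommutativeRing)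

-- Every finite field has prime-power order q, and every such F_q arises.
record FiniteField (c ℓ : Level) : Set (suc (c ⊔ ℓ)) where
  field
    commRing : CommutativeRing c ℓ
  open CommutativeRing commRing public
  field
    1≉0      : ¬ (1# ≈ 0#)
    inverse  : ∀ x → ¬ (x ≈ 0#) → ∃ λ y → (x * y) ≈ 1#
    elements : List Carrier
    complete : ∀ x → Any (x ≈_) elements

module Polynomials {c ℓ : Level} (F : FiniteField c ℓ) where
  open FiniteField F

  -- Polynomials in F[t] as coefficient lists, lowest degree first.
  Poly : Set c
  Poly = List Carrier

  coeff : Poly → ℕ → Carrier
  coeff []       _         = 0#
  coeff (a ∷ p)  ℕ.zero    = a
  coeff (a ∷ p)  (ℕ.suc n) = coeff p n

  _≈ₚ_ : Poly → Poly → Set ℓ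
  p ≈ₚ q = ∀ n → coeff p n ≈ coeff q n

  _+ₚ_ : Poly → Poly → Poly
  []      +ₚ q       = q
  (a ∷ p) +ₚ []      = a ∷ p
  (a ∷ p) +ₚ (b ∷ q) = (a + b) ∷ (p +ₚ q)

  _*ₚ_ : Poly → Poly → Poly
  []      *ₚ q = []
  (a ∷ p) *ₚ q = map (a *_) q +ₚ (0# ∷ (p *ₚ q))

  _∣ₚ_ : Poly → Poly → Set (c ⊔ ℓ)
  p ∣ₚ q = ∃ λ e → (p *ₚ e) ≈ₚ q

  -- A monic polynomial of degree k is given by its k lower coefficients
  -- a_0, ..., a_{k-1}; it is a_0 + a_1 t + ... + a_{k-1} t^{k-1} + t^k.
  -- So Vec Carrier k is in bijection with M(k).
  monic : ∀ {k} → Vec Carrier k → Poly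
  monic a = toList a ++ [ 1# ]

  -- reciprocal a*(t) = t^k a(1/t) of a monic a of degree k:
  -- the coefficient list of length k+1 reversed.
  reciprocal : ∀ {k} → Vec Carrier k → Poly
  reciprocal a = reverse (monic a)

  Monic : Set c
  Monic = Σ ℕ (Vec Carrier)

  poly : Monic → Poly
  poly (d , a) = monic a

  _≈ₘ_ : Monic → Monic → Set ℓ
  m ≈ₘ m' = poly m ≈ₚ poly m'

{-# OPTIONS --safe #-}
module Submission where

-- Let g = gcd(a, b), a = gα, b = gβ with α, β monic of degree e and uα + vβ = 1.
-- Taking reciprocals is multiplicative, so a*a = b*b reads g*α* gα = g*β* gβ; g is monic
-- and g* has constant term 1, so both cancel and α*α = β*β. Then α divides β*β, hence β*,
-- and as deg β* ≤ e = deg α, β* = sα with s a unit (compare constant terms). So α, and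
-- with it a, is determined by b and g: a ↦ gcd(a, b) is injective into the monic
-- divisors of b.
--
-- Euclid's algorithm must decide whether a coefficient vanishes, which F does not
-- provide. As F is finite, that decidability holds up to double negation, and since the
-- conclusion is a decidable inequality of naturals we may assume it.

open import Defs
open import Level using (Level; _⊔_)
open import Algebra.Bundles using (CommutativeRing; CommutativeSemigroup)
import Algebra.Properties.CommutativeSemigroup as CommutativeSemigroupProperties
import Algebra.Properties.Group as GroupProperties
import Algebra.Properties.Ring as RingProperties
import Algebra.Solver.Ring.NaturalCoefficients.Default as NaturalCoefficients
open import Data.Fin using (Fin; toℕ; punchIn; punchOut)
open import Data.Fin.Properties using (punchIn-punchOut)
open import Data.List using (List; []; _∷_; _++_; _∷ʳ_; map; length; lookup; reverse; applyUpTo)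
open import Data.List.Properties using (applyUpTo-∷ʳ; length-applyUpTo; map-applyUpTo; unfold-reverse; length-reverse)
open import Data.List.Relation.Unary.All as All using (All; []; _∷_; lookupAny)
open import Data.List.Relation.Unary.Any as Any using (Any)
open import Data.List.Relation.Unary.Any.Properties using (lookup-index)
open import Data.List.Relation.Unary.AllPairs using (AllPairs; []; _∷_)
open import Data.Nat as ℕ using (ℕ; zero; suc; _∸_; _≤_; _<_; z≤n; s≤s; _≤?_)
open import Data.Nat.Induction using (<-wellFounded)
import Data.Nat.Properties as ℕₚ
open import Data.Product using (Σ; ∃; _,_; _×_; proj₁; proj₂)
open import Data.Sum using (_⊎_; inj₁; inj₂)
open import Data.Vec using (Vec; tabulate) renaming ([] to []ᵥ; _∷_ to _∷ᵥ_)
open import Data.Empty using (⊥-elim)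
open import Induction.WellFounded using (Acc; acc)
open import Relation.Binary.Bundles using (Setoid)
open import Relation.Binary.Core using (Rel)
open import Relation.Binary.Definitions using (tri<; tri≈; tri>)
open import Relation.Binary.Structures using (IsEquivalence)
import Relation.Binary.PropositionalEquality as ≡
import Relation.Binary.Reasoning.Setoid as SetoidReasoning
open import Relation.Nullary using (¬_; Dec; yes; no)
open import Relation.Nullary.Decidable using (map′; decidable-stable; ¬¬-excluded-middle)
open import Relation.Nullary.Negation using (¬¬-map)

module CommutativeRingLemmas {c ℓ : Level} (R : CommutativeRing c ℓ) where
  open CommutativeRing R
  open RingProperties ring using (x[y-z]≈xy-xz; [y-z]x≈yx-zx)
  open GroupProperties +-group using (x∙y⁻¹≈ε⇒x≈y; x≈y⇒x∙y⁻¹≈ε)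
  open NaturalCoefficients commutativeSemiring using (solve; _:+_; _:*_; _:=_)
  open SetoidReasoning setoid

  cancelˡ : ∀ {g} → (∀ {w} → g * w ≈ 0# → w ≈ 0#) → ∀ {x y} → g * x ≈ g * y → x ≈ y
  cancelˡ {g} noZeroDivisor {x} {y} gx≈gy = x∙y⁻¹≈ε⇒x≈y x y (noZeroDivisor (begin
    g * (x - y)    ≈⟨ x[y-z]≈xy-xz g x y ⟩
    g * x - g * y  ≈⟨ x≈y⇒x∙y⁻¹≈ε gx≈gy ⟩
    0#             ∎))

  x+y≈[z+x]+[y-z] : ∀ x y z → x + y ≈ (z + x) + (y - z)
  x+y≈[z+x]+[y-z] x y z = begin
    x + y              ≈⟨ +-identityʳ (x + y) ⟨
    (x + y) + 0#       ≈⟨ +-congˡ (-‿inverseʳ z) ⟨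
    (x + y) + (z - z)  ≈⟨ regroup x y z (- z) ⟩
    (z + x) + (y - z)  ∎
    where
    regroup : ∀ x y z n → (x + y) + (z + n) ≈ (z + x) + (y + n)
    regroup = solve 4 (λ x y z n → (x :+ y) :+ (z :+ n) := (z :+ x) :+ (y :+ n)) refl

  coprime-divisor : ∀ {a b u v r s} → u * a + v * b ≈ 1# → r * b ≈ s * a → r ≈ a * (u * r + v * s)
  coprime-divisor {a} {b} {u} {v} {r} {s} bezout rb≈sa = begin
    r                          ≈⟨ *-identityʳ r ⟨
    r * 1#                     ≈⟨ *-congˡ bezout ⟨
    r * (u * a + v * b)        ≈⟨ expand a b u v r ⟩
    a * (u * r) + v * (r * b)  ≈⟨ +-congˡ (*-congˡ rb≈sa) ⟩
    a * (u * r) + v * (s * a)  ≈⟨ collect a u v r s ⟩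
    a * (u * r + v * s)        ∎
    where
    expand : ∀ a b u v r → r * (u * a + v * b) ≈ a * (u * r) + v * (r * b)
    expand = solve 5 (λ a b u v r → r :* (u :* a :+ v :* b) := a :* (u :* r) :+ v :* (r :* b)) refl
    collect : ∀ a u v r s → a * (u * r) + v * (s * a) ≈ a * (u * r + v * s)
    collect = solve 5 (λ a u v r s → a :* (u :* r) :+ v :* (s :* a) := a :* (u :* r :+ v :* s)) refl

  bezout-step : ∀ {ρ a u v q c y} → u * ρ + v * a ≈ 1# → c * y ≈ 1# →
                (v - y * u * q) * a + (y * u) * (q * a + c * ρ) ≈ 1#
  bezout-step {ρ} {a} {u} {v} {q} {c} {y} bezout cy≈1 = begin
    (v - y * u * q) * a + (y * u) * (q * a + c * ρ)
      ≈⟨ +-cong ([y-z]x≈yx-zx a v (y * u * q)) (expand ρ a u q c y) ⟩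
    (v * a - t) + (t + (y * c) * (u * ρ))
      ≈⟨ regroup (v * a) (- t) t ((y * c) * (u * ρ)) ⟩
    (- t + t) + ((y * c) * (u * ρ) + v * a)
      ≈⟨ +-cong (-‿inverseˡ t) (+-congʳ (*-congʳ (trans (*-comm y c) cy≈1))) ⟩
    0# + (1# * (u * ρ) + v * a)
      ≈⟨ trans (+-identityˡ _) (+-congʳ (*-identityˡ _)) ⟩
    u * ρ + v * a
      ≈⟨ bezout ⟩
    1# ∎
    where
    t : Carrier
    t = y * u * q * a
    expand : ∀ ρ a u q c y → (y * u) * (q * a + c * ρ) ≈ y * u * q * a + (y * c) * (u * ρ)
    expand = solve 6 (λ ρ a u q c y → (y :* u) :* (q :* a :+ c :* ρ) := y :* u :* q :* a :+ (y :* c) :* (u :* ρ)) refl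
    regroup : ∀ w x y z → (w + x) + (y + z) ≈ (x + y) + (z + w)
    regroup = solve 4 (λ w x y z → (w :+ x) :+ (y :+ z) := (x :+ y) :+ (z :+ w)) refl

pigeonhole : ∀ {a r p} {X : Set a} {R : Rel X r} n (Label : X → Fin n → Set p) →
  (∀ {x y i} → Label x i → Label y i → ¬ R x y) →
  ∀ xs → AllPairs R xs → All (λ x → ∃ (Label x)) xs → length xs ≤ n
pigeonhole n       Label distinct []       _        _ = z≤n
pigeonhole zero    Label distinct (x ∷ xs) _ ((() , _) ∷ _)
pigeonhole {R = R} (suc n) Label distinct (x ∷ xs) (Rxxs ∷ xs-pairwise) ((i , xᵢ) ∷ labels) =
  s≤s (pigeonhole n (λ y j → Label y (punchIn i j)) distinct xs xs-pairwise (relabel Rxxs labels))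
  where
  relabel : ∀ {ys} → All (R x) ys → All (λ y → ∃ (Label y)) ys → All (λ y → ∃ λ j → Label y (punchIn i j)) ys
  relabel []           []                 = []
  relabel (Rxy ∷ Rxys) ((j , yⱼ) ∷ labels) =
    (punchOut i≢j , ≡.subst (Label _) (≡.sym (punchIn-punchOut i≢j)) yⱼ) ∷ relabel Rxys labels
    where
    i≢j : ¬ i ≡.≡ j
    i≢j ≡.refl = distinct xᵢ yⱼ Rxy

¬¬-all-decidable : ∀ {a p} {A : Set a} (P : A → Set p) xs → ¬ ¬ All (λ x → Dec (P x)) xs
¬¬-all-decidable P []       k = k []
¬¬-all-decidable P (x ∷ xs) k = ¬¬-excluded-middle (λ Px? → ¬¬-all-decidable P xs (λ Pxs? → k (Px? ∷ Pxs?)))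

module PolynomialRing {c ℓ : Level} (F : FiniteField c ℓ) where
  open FiniteField F
  -- Defs gives _+ₚ_ and _*ₚ_ no fixity; every module below re-opens them with the usual one.
  open Polynomials F renaming (_+ₚ_ to infixl 6 _+ₚ_; _*ₚ_ to infixl 7 _*ₚ_)
  open RingProperties ring using (-0#≈0#)

  -- A record rather than _≈ₚ_ itself, so that p and q can be inferred from a proof.
  infix 4 _≋_
  record _≋_ (p q : Poly) : Set ℓ where
    constructor ⟨_⟩
    field at : p ≈ₚ q
  open _≋_ public

  ≋-refl : ∀ {p} → p ≋ p
  ≋-refl = ⟨ (λ _ → refl) ⟩

  ≋-sym : ∀ {p q} → p ≋ q → q ≋ p
  ≋-sym p≋q = ⟨ (λ n → sym (at p≋q n)) ⟩

  ≋-trans : ∀ {p q r} → p ≋ q → q ≋ r → p ≋ r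
  ≋-trans p≋q q≋r = ⟨ (λ n → trans (at p≋q n) (at q≋r n)) ⟩

  ≡⇒≋ : ∀ {p q} → p ≡.≡ q → p ≋ q
  ≡⇒≋ ≡.refl = ≋-refl

  ≋-isEquivalence : IsEquivalence _≋_
  ≋-isEquivalence = record { refl = ≋-refl ; sym = ≋-sym ; trans = ≋-trans }

  ≋-setoid : Setoid c ℓ
  ≋-setoid = record { isEquivalence = ≋-isEquivalence }

  module ≈-Reasoning = SetoidReasoning setoid
  module ≋-Reasoning = SetoidReasoning ≋-setoid

  X : Poly → Poly
  X p = 0# ∷ p

  infixr 7 _·_
  _·_ : Carrier → Poly → Poly
  a · p = map (a *_) p

  -ₚ_ : Poly → Poly
  -ₚ p = map -_ p

  1ₚ : Poly
  1ₚ = 1# ∷ []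

  ∷-cong : ∀ {a b p q} → a ≈ b → p ≋ q → a ∷ p ≋ b ∷ q
  ∷-cong a≈b p≋q = ⟨ (λ { zero → a≈b ; (suc n) → at p≋q n }) ⟩

  ∷-injectiveʳ : ∀ {a b p q} → a ∷ p ≋ b ∷ q → p ≋ q
  ∷-injectiveʳ e = ⟨ (λ n → at e (suc n)) ⟩

  X-cong : ∀ {p q} → p ≋ q → X p ≋ X q
  X-cong = ∷-cong refl

  X[]≋[] : X [] ≋ []
  X[]≋[] = ⟨ (λ { zero → refl ; (suc n) → refl }) ⟩

  coeff-+ₚ : ∀ p q n → coeff (p +ₚ q) n ≈ coeff p n + coeff q n
  coeff-+ₚ []      q       n       = sym (+-identityˡ _)
  coeff-+ₚ (a ∷ p) []      n       = sym (+-identityʳ _)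
  coeff-+ₚ (a ∷ p) (b ∷ q) zero    = refl
  coeff-+ₚ (a ∷ p) (b ∷ q) (suc n) = coeff-+ₚ p q n

  coeff-· : ∀ a p n → coeff (a · p) n ≈ a * coeff p n
  coeff-· a []      n       = sym (zeroʳ a)
  coeff-· a (b ∷ p) zero    = refl
  coeff-· a (b ∷ p) (suc n) = coeff-· a p n

  coeff--ₚ : ∀ p n → coeff (-ₚ p) n ≈ - coeff p n
  coeff--ₚ []      n       = sym -0#≈0#
  coeff--ₚ (b ∷ p) zero    = refl
  coeff--ₚ (b ∷ p) (suc n) = coeff--ₚ p n

  coeff-*ₚ-∷ : ∀ a p q n → coeff ((a ∷ p) *ₚ q) n ≈ a * coeff q n + coeff (X (p *ₚ q)) n
  coeff-*ₚ-∷ a p q n = trans (coeff-+ₚ (a · q) (X (p *ₚ q)) n) (+-congʳ (coeff-· a q n))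

  +ₚ-cong : ∀ {p p′ q q′} → p ≋ p′ → q ≋ q′ → p +ₚ q ≋ p′ +ₚ q′
  +ₚ-cong {p} {p′} {q} {q′} p≋p′ q≋q′ = ⟨ (λ n →
    trans (coeff-+ₚ p q n) (trans (+-cong (at p≋p′ n) (at q≋q′ n)) (sym (coeff-+ₚ p′ q′ n)))) ⟩

  ·-cong : ∀ {a b p q} → a ≈ b → p ≋ q → a · p ≋ b · q
  ·-cong {a} {b} {p} {q} a≈b p≋q = ⟨ (λ n →
    trans (coeff-· a p n) (trans (*-cong a≈b (at p≋q n)) (sym (coeff-· b q n)))) ⟩

  -ₚ-cong : ∀ {p q} → p ≋ q → -ₚ p ≋ -ₚ q
  -ₚ-cong {p} {q} p≋q = ⟨ (λ n →
    trans (coeff--ₚ p n) (trans (-‿cong (at p≋q n)) (sym (coeff--ₚ q n)))) ⟩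

  +ₚ-identityʳ : ∀ p → p +ₚ [] ≋ p
  +ₚ-identityʳ []      = ≋-refl
  +ₚ-identityʳ (a ∷ p) = ≋-refl

  +ₚ-comm : ∀ p q → p +ₚ q ≋ q +ₚ p
  +ₚ-comm p q = ⟨ (λ n → trans (coeff-+ₚ p q n) (trans (+-comm _ _) (sym (coeff-+ₚ q p n)))) ⟩

  +ₚ-assoc : ∀ p q r → (p +ₚ q) +ₚ r ≋ p +ₚ (q +ₚ r)
  +ₚ-assoc p q r = ⟨ (λ n → begin
    coeff ((p +ₚ q) +ₚ r) n            ≈⟨ trans (coeff-+ₚ (p +ₚ q) r n) (+-congʳ (coeff-+ₚ p q n)) ⟩
    (coeff p n + coeff q n) + coeff r n ≈⟨ +-assoc _ _ _ ⟩
    coeff p n + (coeff q n + coeff r n) ≈⟨ sym (trans (coeff-+ₚ p (q +ₚ r) n) (+-congˡ (coeff-+ₚ q r n))) ⟩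
    coeff (p +ₚ (q +ₚ r)) n            ∎) ⟩
    where open ≈-Reasoning

  -ₚ-inverseˡ : ∀ p → (-ₚ p) +ₚ p ≋ []
  -ₚ-inverseˡ p = ⟨ (λ n →
    trans (coeff-+ₚ (-ₚ p) p n) (trans (+-congʳ (coeff--ₚ p n)) (-‿inverseˡ _))) ⟩

  -ₚ-inverseʳ : ∀ p → p +ₚ (-ₚ p) ≋ []
  -ₚ-inverseʳ p = ≋-trans (+ₚ-comm p (-ₚ p)) (-ₚ-inverseˡ p)

  +ₚ-commutativeSemigroup : CommutativeSemigroup c ℓ
  +ₚ-commutativeSemigroup = record
    { _≈_ = _≋_ ; _∙_ = _+ₚ_
    ; isCommutativeSemigroup = record
      { isSemigroup = record
        { isMagma = record { isEquivalence = ≋-isEquivalence ; ∙-cong = +ₚ-cong }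
        ; assoc = +ₚ-assoc }
      ; comm = +ₚ-comm } }

  open CommutativeSemigroupProperties +ₚ-commutativeSemigroup using (interchange; x∙yz≈y∙xz)

  X-+ₚ : ∀ p q → X (p +ₚ q) ≋ X p +ₚ X q
  X-+ₚ p q = ∷-cong (sym (+-identityˡ 0#)) ≋-refl

  X-· : ∀ a p → X (a · p) ≋ a · X p
  X-· a p = ∷-cong (sym (zeroʳ a)) ≋-refl

  ·-·-assoc : ∀ a b p → a · (b · p) ≋ (a * b) · p
  ·-·-assoc a b p = ⟨ (λ n →
    trans (coeff-· a (b · p) n) (trans (*-congˡ (coeff-· b p n))
      (trans (sym (*-assoc a b _)) (sym (coeff-· (a * b) p n))))) ⟩

  ·-identity : ∀ {a} p → a ≈ 1# → a · p ≋ p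
  ·-identity {a} p a≈1 = ⟨ (λ n → trans (coeff-· a p n) (trans (*-congʳ a≈1) (*-identityˡ _))) ⟩

  ·-zeroˡ : ∀ p → 0# · p ≋ []
  ·-zeroˡ p = ⟨ (λ n → trans (coeff-· 0# p n) (zeroˡ _)) ⟩

  ·-distribˡ : ∀ a p q → a · (p +ₚ q) ≋ a · p +ₚ a · q
  ·-distribˡ a p q = ⟨ (λ n → begin
    coeff (a · (p +ₚ q)) n              ≈⟨ trans (coeff-· a (p +ₚ q) n) (*-congˡ (coeff-+ₚ p q n)) ⟩
    a * (coeff p n + coeff q n)         ≈⟨ distribˡ a _ _ ⟩
    a * coeff p n + a * coeff q n       ≈⟨ sym (trans (coeff-+ₚ (a · p) (a · q) n) (+-cong (coeff-· a p n) (coeff-· a q n))) ⟩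
    coeff (a · p +ₚ a · q) n            ∎) ⟩
    where open ≈-Reasoning

  ·-distribʳ : ∀ a b p → (a + b) · p ≋ a · p +ₚ b · p
  ·-distribʳ a b p = ⟨ (λ n → begin
    coeff ((a + b) · p) n               ≈⟨ coeff-· (a + b) p n ⟩
    (a + b) * coeff p n                 ≈⟨ distribʳ _ a b ⟩
    a * coeff p n + b * coeff p n       ≈⟨ sym (trans (coeff-+ₚ (a · p) (b · p) n) (+-cong (coeff-· a p n) (coeff-· b p n))) ⟩
    coeff (a · p +ₚ b · p) n            ∎) ⟩
    where open ≈-Reasoning

  *ₚ-zeroˡ : ∀ p q → p ≋ [] → p *ₚ q ≋ []
  *ₚ-zeroˡ []      q p≋[]   = ≋-refl
  *ₚ-zeroˡ (a ∷ p) q a∷p≋[] = begin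
    a · q +ₚ X (p *ₚ q)   ≈⟨ +ₚ-cong (·-cong (at a∷p≋[] 0) ≋-refl) (X-cong (*ₚ-zeroˡ p q p≋[])) ⟩
    0# · q +ₚ X []        ≈⟨ +ₚ-cong (·-zeroˡ q) X[]≋[] ⟩
    []                    ∎
    where
    open ≋-Reasoning
    p≋[] : p ≋ []
    p≋[] = ⟨ (λ n → at a∷p≋[] (suc n)) ⟩

  *ₚ-zeroʳ : ∀ p → p *ₚ [] ≋ []
  *ₚ-zeroʳ []      = ≋-refl
  *ₚ-zeroʳ (a ∷ p) = ≋-trans (X-cong (*ₚ-zeroʳ p)) X[]≋[]

  *ₚ-congˡ : ∀ {p p′} q → p ≋ p′ → p *ₚ q ≋ p′ *ₚ q
  *ₚ-congˡ {[]}    {p′}     q e = ≋-sym (*ₚ-zeroˡ p′ q (≋-sym e))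
  *ₚ-congˡ {a ∷ p} {[]}     q e = *ₚ-zeroˡ (a ∷ p) q e
  *ₚ-congˡ {a ∷ p} {b ∷ p′} q e =
    +ₚ-cong (·-cong (at e 0) ≋-refl) (X-cong (*ₚ-congˡ q (∷-injectiveʳ e)))

  *ₚ-∷ʳ : ∀ p b q → p *ₚ (b ∷ q) ≋ b · p +ₚ X (p *ₚ q)
  *ₚ-∷ʳ []      b q = ≋-sym X[]≋[]
  *ₚ-∷ʳ (a ∷ p) b q = ∷-cong (+-congʳ (*-comm a b)) (begin
    a · q +ₚ p *ₚ (b ∷ q)           ≈⟨ +ₚ-cong ≋-refl (*ₚ-∷ʳ p b q) ⟩
    a · q +ₚ (b · p +ₚ X (p *ₚ q))  ≈⟨ x∙yz≈y∙xz (a · q) (b · p) (X (p *ₚ q)) ⟩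
    b · p +ₚ (a · q +ₚ X (p *ₚ q))  ∎)
    where open ≋-Reasoning

  *ₚ-comm : ∀ p q → p *ₚ q ≋ q *ₚ p
  *ₚ-comm []      q = ≋-sym (*ₚ-zeroʳ q)
  *ₚ-comm (a ∷ p) q = ≋-trans (+ₚ-cong ≋-refl (X-cong (*ₚ-comm p q))) (≋-sym (*ₚ-∷ʳ q a p))

  *ₚ-distribʳ : ∀ p p′ q → (p +ₚ p′) *ₚ q ≋ p *ₚ q +ₚ p′ *ₚ q
  *ₚ-distribʳ []      p′       q = ≋-refl
  *ₚ-distribʳ (a ∷ p) []       q = ≋-sym (+ₚ-identityʳ _)
  *ₚ-distribʳ (a ∷ p) (b ∷ p′) q = begin
    (a + b) · q +ₚ X ((p +ₚ p′) *ₚ q)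
      ≈⟨ +ₚ-cong (·-distribʳ a b q) (X-cong (*ₚ-distribʳ p p′ q)) ⟩
    (a · q +ₚ b · q) +ₚ X (p *ₚ q +ₚ p′ *ₚ q)
      ≈⟨ +ₚ-cong ≋-refl (X-+ₚ (p *ₚ q) (p′ *ₚ q)) ⟩
    (a · q +ₚ b · q) +ₚ (X (p *ₚ q) +ₚ X (p′ *ₚ q))
      ≈⟨ interchange (a · q) (b · q) (X (p *ₚ q)) (X (p′ *ₚ q)) ⟩
    (a · q +ₚ X (p *ₚ q)) +ₚ (b · q +ₚ X (p′ *ₚ q))
      ∎
    where open ≋-Reasoning

  ·-*ₚ : ∀ a q r → (a · q) *ₚ r ≋ a · (q *ₚ r)
  ·-*ₚ a []      r = ≋-refl
  ·-*ₚ a (b ∷ q) r = begin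
    (a * b) · r +ₚ X ((a · q) *ₚ r)
      ≈⟨ +ₚ-cong (≋-sym (·-·-assoc a b r)) (≋-trans (X-cong (·-*ₚ a q r)) (X-· a (q *ₚ r))) ⟩
    a · (b · r) +ₚ a · X (q *ₚ r)
      ≈⟨ ·-distribˡ a (b · r) (X (q *ₚ r)) ⟨
    a · (b · r +ₚ X (q *ₚ r))
      ∎
    where open ≋-Reasoning

  X-*ₚ : ∀ p q → X p *ₚ q ≋ X (p *ₚ q)
  X-*ₚ p q = +ₚ-cong (·-zeroˡ q) ≋-refl

  *ₚ-assoc : ∀ p q r → (p *ₚ q) *ₚ r ≋ p *ₚ (q *ₚ r)
  *ₚ-assoc []      q r = ≋-refl
  *ₚ-assoc (a ∷ p) q r = begin
    (a · q +ₚ X (p *ₚ q)) *ₚ r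
      ≈⟨ *ₚ-distribʳ (a · q) (X (p *ₚ q)) r ⟩
    (a · q) *ₚ r +ₚ X (p *ₚ q) *ₚ r
      ≈⟨ +ₚ-cong (·-*ₚ a q r) (≋-trans (X-*ₚ (p *ₚ q) r) (X-cong (*ₚ-assoc p q r))) ⟩
    a · (q *ₚ r) +ₚ X (p *ₚ (q *ₚ r))
      ∎
    where open ≋-Reasoning

  const-*ₚ : ∀ a p → (a ∷ []) *ₚ p ≋ a · p
  const-*ₚ a p = ≋-trans (+ₚ-cong (≋-refl {a · p}) X[]≋[]) (+ₚ-identityʳ (a · p))

  *ₚ-const : ∀ a p → p *ₚ (a ∷ []) ≋ a · p
  *ₚ-const a p = ≋-trans (*ₚ-comm p (a ∷ [])) (const-*ₚ a p)

  *ₚ-identityˡ : ∀ q → 1ₚ *ₚ q ≋ q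
  *ₚ-identityˡ q = ≋-trans (const-*ₚ 1# q) (·-identity q refl)

  *ₚ-identityʳ : ∀ q → q *ₚ 1ₚ ≋ q
  *ₚ-identityʳ q = ≋-trans (*ₚ-comm q 1ₚ) (*ₚ-identityˡ q)

  *ₚ-cong : ∀ {p p′ q q′} → p ≋ p′ → q ≋ q′ → p *ₚ q ≋ p′ *ₚ q′
  *ₚ-cong {p} {p′} {q} {q′} p≋p′ q≋q′ = begin
    p *ₚ q    ≈⟨ *ₚ-congˡ q p≋p′ ⟩
    p′ *ₚ q   ≈⟨ *ₚ-comm p′ q ⟩
    q *ₚ p′   ≈⟨ *ₚ-congˡ p′ q≋q′ ⟩
    q′ *ₚ p′  ≈⟨ *ₚ-comm q′ p′ ⟩
    p′ *ₚ q′  ∎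
    where open ≋-Reasoning

  polynomialRing : CommutativeRing c ℓ
  polynomialRing = record
    { Carrier = Poly ; _≈_ = _≋_ ; _+_ = _+ₚ_ ; _*_ = _*ₚ_ ; -_ = -ₚ_ ; 0# = [] ; 1# = 1ₚ
    ; isCommutativeRing = record
      { isRing = record
        { +-isAbelianGroup = record
          { isGroup = record
            { isMonoid = record
              { isSemigroup = CommutativeSemigroup.isSemigroup +ₚ-commutativeSemigroup
              ; identity = (λ p → ≋-refl) , +ₚ-identityʳ }
            ; inverse = -ₚ-inverseˡ , -ₚ-inverseʳ
            ; ⁻¹-cong = -ₚ-cong }
          ; comm = +ₚ-comm }
        ; *-cong = *ₚ-cong
        ; *-assoc = *ₚ-assoc
        ; *-identity = *ₚ-identityˡ , *ₚ-identityʳ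
        ; distrib = (λ p q q′ → ≋-trans (*ₚ-comm p (q +ₚ q′))
                                  (≋-trans (*ₚ-distribʳ q q′ p) (+ₚ-cong (*ₚ-comm q p) (*ₚ-comm q′ p))))
                  , (λ q p p′ → *ₚ-distribʳ p p′ q) }
      ; *-comm = *ₚ-comm } }

module Degree {c ℓ : Level} (F : FiniteField c ℓ) where
  open FiniteField F
  open Polynomials F renaming (_+ₚ_ to infixl 6 _+ₚ_; _*ₚ_ to infixl 7 _*ₚ_)
  open PolynomialRing F
  open CommutativeRingLemmas polynomialRing using (cancelˡ; x+y≈[z+x]+[y-z])
  open RingProperties ring using (-0#≈0#)

  infix 4 deg_<_
  record deg_<_ (p : Poly) (n : ℕ) : Set ℓ where
    constructor vanishing
    field vanishes : ∀ i → n ≤ i → coeff p i ≈ 0#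
  open deg_<_ public

  deg<-cong : ∀ {n p q} → p ≋ q → deg p < n → deg q < n
  deg<-cong p≋q p<n = vanishing (λ i n≤i → trans (sym (at p≋q i)) (vanishes p<n i n≤i))

  deg<-mono : ∀ {m n p} → m ≤ n → deg p < m → deg p < n
  deg<-mono m≤n p<m = vanishing (λ i n≤i → vanishes p<m i (ℕₚ.≤-trans m≤n n≤i))

  deg<-length : ∀ p → deg p < length p
  deg<-length []      = vanishing (λ _ _ → refl)
  deg<-length (a ∷ p) = vanishing λ { (suc i) (s≤s l≤i) → vanishes (deg<-length p) i l≤i }

  deg<-tail : ∀ {n a p} → deg a ∷ p < suc n → deg p < n
  deg<-tail a∷p<1+n = vanishing (λ i n≤i → vanishes a∷p<1+n (suc i) (s≤s n≤i))

  deg<-lower : ∀ {n p} → deg p < suc n → coeff p n ≈ 0# → deg p < n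
  deg<-lower {n} {p} p<1+n pₙ≈0 = vanishing lower
    where
    lower : ∀ i → n ≤ i → coeff p i ≈ 0#
    lower i n≤i with ℕₚ.m≤n⇒m<n∨m≡n n≤i
    ... | inj₁ n<i    = vanishes p<1+n i n<i
    ... | inj₂ ≡.refl = pₙ≈0

  deg<0⇒≋[] : ∀ {p} → deg p < 0 → p ≋ []
  deg<0⇒≋[] p<0 = ⟨ (λ n → vanishes p<0 n z≤n) ⟩

  deg<1⇒constant : ∀ p → deg p < 1 → p ≋ coeff p 0 ∷ []
  deg<1⇒constant []      _   = ⟨ (λ { zero → refl ; (suc n) → refl }) ⟩
  deg<1⇒constant (a ∷ p) a∷p<1 = ∷-cong refl (deg<0⇒≋[] (deg<-tail a∷p<1))

  constant-*ₚ : ∀ {a p} q → deg a ∷ p < 1 → (a ∷ p) *ₚ q ≋ a · q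
  constant-*ₚ {a} q a∷p<1 =
    ≋-trans (*ₚ-congˡ q (∷-cong refl (deg<0⇒≋[] (deg<-tail a∷p<1)))) (const-*ₚ a q)

  record IsMonic (d : ℕ) (p : Poly) : Set ℓ where
    field
      deg< : deg p < suc d
      leading≈1 : coeff p d ≈ 1#
  open IsMonic public

  monic-isMonic : ∀ {k} (a : Vec Carrier k) → IsMonic k (monic a)
  monic-isMonic a = record { deg< = deg<-monic a ; leading≈1 = leading a }
    where
    deg<-monic : ∀ {k} (a : Vec Carrier k) → deg monic a < suc k
    deg<-monic []ᵥ      = vanishing λ { (suc i) _ → refl }
    deg<-monic (x ∷ᵥ a) = vanishing λ { (suc i) (s≤s k<i) → vanishes (deg<-monic a) i k<i }
    leading : ∀ {k} (a : Vec Carrier k) → coeff (monic a) k ≈ 1#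
    leading []ᵥ      = refl
    leading (x ∷ᵥ a) = leading a

  IsMonic-cong : ∀ {d p q} → p ≋ q → IsMonic d p → IsMonic d q
  IsMonic-cong {d} p≋q p-monic = record
    { deg< = deg<-cong p≋q (deg< p-monic)
    ; leading≈1 = trans (sym (at p≋q d)) (leading≈1 p-monic) }

  IsMonic⇒monic : ∀ {d p} → IsMonic d p → Σ (Vec Carrier d) λ a → p ≋ monic a
  IsMonic⇒monic {d} {p} p-monic = tabulate (λ i → coeff p (toℕ i)) , lowerCoefficients d p p-monic
    where
    lowerCoefficients : ∀ d p → IsMonic d p → p ≋ monic (tabulate {n = d} (λ i → coeff p (toℕ i)))
    lowerCoefficients d       []      p-monic = ⊥-elim (1≉0 (sym (leading≈1 p-monic)))
    lowerCoefficients zero    (a ∷ p) p-monic = ∷-cong (leading≈1 p-monic) (deg<0⇒≋[] (deg<-tail (deg< p-monic)))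
    lowerCoefficients (suc d) (a ∷ p) p-monic = ∷-cong refl (lowerCoefficients d p record
      { deg< = deg<-tail (deg< p-monic) ; leading≈1 = leading≈1 p-monic })

  IsMonic-degree-unique : ∀ {d d′ p} → IsMonic d p → IsMonic d′ p → d ≡.≡ d′
  IsMonic-degree-unique {d} {d′} p-monic p-monic′ with ℕₚ.<-cmp d d′
  ... | tri< d<d′ _ _ = ⊥-elim (1≉0 (trans (sym (leading≈1 p-monic′)) (vanishes (deg< p-monic) d′ d<d′)))
  ... | tri≈ _ d≡d′ _ = d≡d′
  ... | tri> _ _ d′<d = ⊥-elim (1≉0 (trans (sym (leading≈1 p-monic)) (vanishes (deg< p-monic′) d d′<d)))

  coeff-*ₚ-top : ∀ {m n} p q → deg p < suc m → deg q < suc n →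
                 coeff (p *ₚ q) (m ℕ.+ n) ≈ coeff p m * coeff q n
  coeff-*ₚ-top []      q p<1+m q<1+n = sym (zeroˡ _)
  coeff-*ₚ-top {zero} {n} (a ∷ p) q a∷p<1 q<1+n = begin
    coeff ((a ∷ p) *ₚ q) n   ≈⟨ at (constant-*ₚ q a∷p<1) n ⟩
    coeff (a · q) n          ≈⟨ coeff-· a q n ⟩
    a * coeff q n            ∎
    where open ≈-Reasoning
  coeff-*ₚ-top {suc m} {n} (a ∷ p) q a∷p<2+m q<1+n = begin
    coeff (a · q +ₚ X (p *ₚ q)) (suc m ℕ.+ n)   ≈⟨ coeff-+ₚ (a · q) (X (p *ₚ q)) (suc m ℕ.+ n) ⟩
    coeff (a · q) (suc m ℕ.+ n) + coeff (p *ₚ q) (m ℕ.+ n)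
      ≈⟨ +-cong (trans (coeff-· a q _) (trans (*-congˡ (vanishes q<1+n _ (s≤s (ℕₚ.m≤n+m n m)))) (zeroʳ a)))
                (coeff-*ₚ-top p q (deg<-tail a∷p<2+m) q<1+n) ⟩
    0# + coeff p m * coeff q n                ≈⟨ +-identityˡ _ ⟩
    coeff p m * coeff q n                     ∎
    where open ≈-Reasoning

  coeff-monic-*ₚ-top : ∀ {d e g} h → IsMonic d g → deg h < suc e → coeff (g *ₚ h) (d ℕ.+ e) ≈ coeff h e
  coeff-monic-*ₚ-top {d} {e} {g} h g-monic h<1+e = begin
    coeff (g *ₚ h) (d ℕ.+ e)  ≈⟨ coeff-*ₚ-top g h (deg< g-monic) h<1+e ⟩
    coeff g d * coeff h e     ≈⟨ *-congʳ (leading≈1 g-monic) ⟩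
    1# * coeff h e            ≈⟨ *-identityˡ _ ⟩
    coeff h e                 ∎
    where open ≈-Reasoning

  deg<-monic-*ₚ⁻¹ : ∀ {d j g} w → IsMonic d g → deg g *ₚ w < d ℕ.+ j → deg w < j
  deg<-monic-*ₚ⁻¹ {d} {j} {g} w g-monic gw<d+j =
    descend (length w) (deg<-mono (ℕₚ.m≤n+m (length w) j) (deg<-length w))
    where
    descend : ∀ b → deg w < j ℕ.+ b → deg w < j
    descend zero    w<j+0   = ≡.subst (deg w <_) (ℕₚ.+-identityʳ j) w<j+0
    descend (suc b) w<j+1+b = descend b (deg<-lower w<1+j+b (begin
      coeff w (j ℕ.+ b)                    ≈⟨ coeff-monic-*ₚ-top w g-monic w<1+j+b ⟨
      coeff (g *ₚ w) (d ℕ.+ (j ℕ.+ b))     ≈⟨ vanishes gw<d+j _ (ℕₚ.+-monoʳ-≤ d (ℕₚ.m≤m+n j b)) ⟩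
      0#                                   ∎))
      where
      open ≈-Reasoning
      w<1+j+b : deg w < suc (j ℕ.+ b)
      w<1+j+b = ≡.subst (deg w <_) (ℕₚ.+-suc j b) w<j+1+b

  monic-*ₚ-zero : ∀ {d g w} → IsMonic d g → g *ₚ w ≋ [] → w ≋ []
  monic-*ₚ-zero {d} {g} {w} g-monic gw≋[] = deg<0⇒≋[] (deg<-monic-*ₚ⁻¹ w g-monic gw<d+0)
    where
    gw<d+0 : deg g *ₚ w < d ℕ.+ 0
    gw<d+0 = vanishing (λ i _ → at gw≋[] i)

  monic-*ₚ-cancelˡ : ∀ {d g x y} → IsMonic d g → g *ₚ x ≋ g *ₚ y → x ≋ y
  monic-*ₚ-cancelˡ {g = g} g-monic = cancelˡ {g} (monic-*ₚ-zero g-monic)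

  const-one-*ₚ-zero : ∀ {h} w → coeff h 0 ≈ 1# → h *ₚ w ≋ [] → w ≋ []
  const-one-*ₚ-zero []      h₀≈1 hw≋[] = ≋-refl
  const-one-*ₚ-zero {h} (x ∷ w) h₀≈1 hw≋[] =
    ≋-trans (∷-cong x≈0 (const-one-*ₚ-zero {h} w h₀≈1 hw≋[]′)) X[]≋[]
    where
    xw≋[] : (x ∷ w) *ₚ h ≋ []
    xw≋[] = ≋-trans (*ₚ-comm (x ∷ w) h) hw≋[]
    x≈0 : x ≈ 0#
    x≈0 = begin
      x                          ≈⟨ trans (*-congˡ h₀≈1) (*-identityʳ x) ⟨
      x * coeff h 0              ≈⟨ +-identityʳ _ ⟨
      x * coeff h 0 + 0#         ≈⟨ coeff-*ₚ-∷ x w h 0 ⟨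
      coeff ((x ∷ w) *ₚ h) 0     ≈⟨ at xw≋[] 0 ⟩
      0#                         ∎
      where open ≈-Reasoning
    hw≋[]′ : h *ₚ w ≋ []
    hw≋[]′ = ≋-trans (*ₚ-comm h w) (∷-injectiveʳ (begin
      X (w *ₚ h)              ≈⟨ +ₚ-cong (·-zeroˡ h) (≋-refl {X (w *ₚ h)}) ⟨
      0# · h +ₚ X (w *ₚ h)    ≈⟨ +ₚ-cong (·-cong x≈0 (≋-refl {h})) (≋-refl {X (w *ₚ h)}) ⟨
      (x ∷ w) *ₚ h            ≈⟨ xw≋[] ⟩
      []                      ≈⟨ X[]≋[] ⟨
      X []                    ∎))
      where open ≋-Reasoning

  const-one-*ₚ-cancelˡ : ∀ {h x y} → coeff h 0 ≈ 1# → h *ₚ x ≋ h *ₚ y → x ≋ y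
  const-one-*ₚ-cancelˡ {h} h₀≈1 = cancelˡ {h} (const-one-*ₚ-zero {h} _ h₀≈1)

  deg<-∷ : ∀ {n a p} → deg p < n → deg a ∷ p < suc n
  deg<-∷ p<n = vanishing λ { (suc i) (s≤s n≤i) → vanishes p<n i n≤i }

  deg<-+ₚ : ∀ {n p q} → deg p < n → deg q < n → deg p +ₚ q < n
  deg<-+ₚ {p = p} {q} p<n q<n = vanishing (λ i n≤i →
    trans (coeff-+ₚ p q i) (trans (+-cong (vanishes p<n i n≤i) (vanishes q<n i n≤i)) (+-identityˡ 0#)))

  deg<-· : ∀ {n p} a → deg p < n → deg a · p < n
  deg<-· {p = p} a p<n = vanishing (λ i n≤i →
    trans (coeff-· a p i) (trans (*-congˡ (vanishes p<n i n≤i)) (zeroʳ a)))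

  deg<--ₚ : ∀ {n p} → deg p < n → deg -ₚ p < n
  deg<--ₚ {p = p} p<n = vanishing (λ i n≤i →
    trans (coeff--ₚ p i) (trans (-‿cong (vanishes p<n i n≤i)) -0#≈0#))

  monic-divisor-degree : ∀ {k d p g h} → IsMonic k p → IsMonic d g → p ≋ g *ₚ h → d ≤ k
  monic-divisor-degree {k} {d} {p} {g} {h} p-monic g-monic p≋gh with d ≤? k
  ... | yes d≤k = d≤k
  ... | no  d≰k = ⊥-elim (1≉0 (begin
    1#                 ≈⟨ leading≈1 p-monic ⟨
    coeff p k          ≈⟨ at p≋gh k ⟩
    coeff (g *ₚ h) k   ≈⟨ at (*ₚ-cong (≋-refl {g}) h≋[]) k ⟩
    coeff (g *ₚ []) k  ≈⟨ at (*ₚ-zeroʳ g) k ⟩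
    0#                 ∎))
    where
    open ≈-Reasoning
    gh<d+0 : deg g *ₚ h < d ℕ.+ 0
    gh<d+0 = deg<-mono (ℕₚ.≤-trans (ℕₚ.≰⇒> d≰k) (ℕₚ.m≤m+n d 0)) (deg<-cong p≋gh (deg< p-monic))
    h≋[] : h ≋ []
    h≋[] = deg<0⇒≋[] (deg<-monic-*ₚ⁻¹ h g-monic gh<d+0)

  monic-cofactor : ∀ {d e p g h} → IsMonic (d ℕ.+ e) p → IsMonic d g → p ≋ g *ₚ h → IsMonic e h
  monic-cofactor {d} {e} {p} {g} {h} p-monic g-monic p≋gh = record
    { deg< = h<1+e
    ; leading≈1 = begin
        coeff h e                 ≈⟨ coeff-monic-*ₚ-top h g-monic h<1+e ⟨
        coeff (g *ₚ h) (d ℕ.+ e)  ≈⟨ at p≋gh (d ℕ.+ e) ⟨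
        coeff p (d ℕ.+ e)         ≈⟨ leading≈1 p-monic ⟩
        1#                        ∎ }
    where
    open ≈-Reasoning
    h<1+e : deg h < suc e
    h<1+e = deg<-monic-*ₚ⁻¹ h g-monic
              (≡.subst (deg g *ₚ h <_) (≡.sym (ℕₚ.+-suc d e)) (deg<-cong p≋gh (deg< p-monic)))

  divMod-monic : ∀ {m A} → IsMonic m A → ∀ B → Σ Poly λ q → Σ Poly λ r → B ≋ q *ₚ A +ₚ r × deg r < m
  divMod-monic A-monic []      = [] , [] , ≋-refl , vanishing (λ _ _ → refl)
  divMod-monic {m} {A} A-monic (x ∷ B) with divMod-monic A-monic B
  ... | q , r , B≋qA+r , r<m = cₘ ∷ q , s +ₚ -ₚ (cₘ · A) , x∷B≋ , r′<m
    where
    s : Poly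
    s = x ∷ r
    cₘ : Carrier
    cₘ = coeff s m
    x∷B≋ : x ∷ B ≋ (cₘ ∷ q) *ₚ A +ₚ (s +ₚ -ₚ (cₘ · A))
    x∷B≋ = begin
      x ∷ B                                 ≈⟨ ∷-cong (+-identityˡ x) (≋-sym B≋qA+r) ⟨
      X (q *ₚ A) +ₚ s                        ≈⟨ x+y≈[z+x]+[y-z] (X (q *ₚ A)) s (cₘ · A) ⟩
      (cₘ · A +ₚ X (q *ₚ A)) +ₚ (s +ₚ -ₚ (cₘ · A)) ∎
      where open ≋-Reasoning
    r′<m : deg s +ₚ -ₚ (cₘ · A) < m
    r′<m = deg<-lower (deg<-+ₚ (deg<-∷ r<m) (deg<--ₚ (deg<-· cₘ (deg< A-monic)))) (begin
      coeff (s +ₚ -ₚ (cₘ · A)) m   ≈⟨ coeff-+ₚ s (-ₚ (cₘ · A)) m ⟩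
      cₘ + coeff (-ₚ (cₘ · A)) m   ≈⟨ +-congˡ (trans (coeff--ₚ (cₘ · A) m) (-‿cong (coeff-· cₘ A m))) ⟩
      cₘ - cₘ * coeff A m          ≈⟨ +-congˡ (-‿cong (trans (*-congˡ (leading≈1 A-monic)) (*-identityʳ cₘ))) ⟩
      cₘ - cₘ                      ≈⟨ -‿inverseʳ cₘ ⟩
      0#                           ∎)
      where open ≈-Reasoning

  scalar-multiple-of-monic : ∀ {e A p} w → IsMonic e A → deg p < suc e → p ≋ A *ₚ w → p ≋ coeff w 0 · A
  scalar-multiple-of-monic {e} {A} {p} w A-monic p<1+e p≋Aw = begin
    p                    ≈⟨ p≋Aw ⟩
    A *ₚ w               ≈⟨ *ₚ-cong (≋-refl {A}) (deg<1⇒constant w w<1) ⟩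
    A *ₚ (coeff w 0 ∷ []) ≈⟨ *ₚ-const (coeff w 0) A ⟩
    coeff w 0 · A        ∎
    where
    open ≋-Reasoning
    w<1 : deg w < 1
    w<1 = deg<-monic-*ₚ⁻¹ w A-monic
            (≡.subst (deg A *ₚ w <_) (ℕₚ.+-comm 1 e) (deg<-cong p≋Aw p<1+e))

  monic-scalar-unique : ∀ {e A A′ a b} → IsMonic e A → IsMonic e A′ → a · A ≋ b · A′ → a ≈ b
  monic-scalar-unique {e} {A} {A′} {a} {b} A-monic A′-monic aA≋bA′ = begin
    a                 ≈⟨ trans (*-congˡ (leading≈1 A-monic)) (*-identityʳ a) ⟨
    a * coeff A e     ≈⟨ coeff-· a A e ⟨
    coeff (a · A) e   ≈⟨ at aA≋bA′ e ⟩
    coeff (b · A′) e  ≈⟨ coeff-· b A′ e ⟩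
    b * coeff A′ e    ≈⟨ trans (*-congˡ (leading≈1 A′-monic)) (*-identityʳ b) ⟩
    b                 ∎
    where open ≈-Reasoning

  ·-cancel-unit : ∀ {y a p q} → y * a ≈ 1# → a · p ≋ a · q → p ≋ q
  ·-cancel-unit {y} {a} {p} {q} ya≈1 ap≋aq = begin
    p              ≈⟨ ·-identity p ya≈1 ⟨
    (y * a) · p    ≈⟨ ·-·-assoc y a p ⟨
    y · (a · p)    ≈⟨ ·-cong refl ap≋aq ⟩
    y · (a · q)    ≈⟨ ·-·-assoc y a q ⟩
    (y * a) · q    ≈⟨ ·-identity q ya≈1 ⟩
    q              ∎
    where open ≋-Reasoning

module Reversal {c ℓ : Level} (F : FiniteField c ℓ) where
  open FiniteField F
  open Polynomials F renaming (_+ₚ_ to infixl 6 _+ₚ_; _*ₚ_ to infixl 7 _*ₚ_)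
  open PolynomialRing F
  open Degree F

  shift : ℕ → Poly → Poly
  shift zero    p = p
  shift (suc m) p = X (shift m p)

  shift-cong : ∀ m {p q} → p ≋ q → shift m p ≋ shift m q
  shift-cong zero    p≋q = p≋q
  shift-cong (suc m) p≋q = X-cong (shift-cong m p≋q)

  shift-[] : ∀ m → shift m [] ≋ []
  shift-[] zero    = ≋-refl
  shift-[] (suc m) = ≋-trans (X-cong (shift-[] m)) X[]≋[]

  shift-*ₚ : ∀ m p q → shift m p *ₚ q ≋ shift m (p *ₚ q)
  shift-*ₚ zero    p q = ≋-refl
  shift-*ₚ (suc m) p q = ≋-trans (X-*ₚ (shift m p) q) (X-cong (shift-*ₚ m p q))

  ·-shift : ∀ a m p → a · shift m p ≋ shift m (a · p)
  ·-shift a zero    p = ≋-refl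
  ·-shift a (suc m) p = ∷-cong (zeroʳ a) (·-shift a m p)

  ++≋+ₚ-shift : ∀ ys zs → ys ++ zs ≋ ys +ₚ shift (length ys) zs
  ++≋+ₚ-shift []       zs = ≋-refl
  ++≋+ₚ-shift (y ∷ ys) zs = ∷-cong (sym (+-identityʳ y)) (++≋+ₚ-shift ys zs)

  applyUpTo-cong : ∀ {f g} n → (∀ i → i < n → f i ≈ g i) → applyUpTo f n ≋ applyUpTo g n
  applyUpTo-cong zero    f≈g = ≋-refl
  applyUpTo-cong (suc n) f≈g = ∷-cong (f≈g 0 (s≤s ℕ.z≤n)) (applyUpTo-cong n (λ i i<n → f≈g (suc i) (s≤s i<n)))

  applyUpTo-+ₚ : ∀ f g n → applyUpTo f n +ₚ applyUpTo g n ≡.≡ applyUpTo (λ i → f i + g i) n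
  applyUpTo-+ₚ f g zero    = ≡.refl
  applyUpTo-+ₚ f g (suc n) = ≡.cong (f 0 + g 0 ∷_) (applyUpTo-+ₚ (λ i → f (suc i)) (λ i → g (suc i)) n)

  applyUpTo-0# : ∀ n → applyUpTo (λ _ → 0#) n ≋ []
  applyUpTo-0# zero    = ≋-refl
  applyUpTo-0# (suc n) = ≋-trans (X-cong (applyUpTo-0# n)) X[]≋[]

  -- t^N p(1/t): the reciprocal of p with respect to the degree bound N.
  rev : ℕ → Poly → Poly
  rev N p = applyUpTo (λ i → coeff p (N ∸ i)) (suc N)

  deg-rev : ∀ N p → deg rev N p < suc N
  deg-rev N p = ≡.subst (deg rev N p <_) (length-applyUpTo (λ i → coeff p (N ∸ i)) (suc N)) (deg<-length (rev N p))

  rev-cong : ∀ N {p q} → p ≋ q → rev N p ≋ rev N q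
  rev-cong N {p} p≋q = applyUpTo-cong {λ i → coeff p (N ∸ i)} (suc N) (λ i _ → at p≋q (N ∸ i))

  rev-+ₚ : ∀ N p q → rev N (p +ₚ q) ≋ rev N p +ₚ rev N q
  rev-+ₚ N p q = ≋-trans (applyUpTo-cong {λ i → coeff (p +ₚ q) (N ∸ i)} (suc N) (λ i _ → coeff-+ₚ p q (N ∸ i)))
                         (≡⇒≋ (≡.sym (applyUpTo-+ₚ (λ i → coeff p (N ∸ i)) (λ i → coeff q (N ∸ i)) (suc N))))

  rev-· : ∀ N a p → rev N (a · p) ≋ a · rev N p
  rev-· N a p = ≋-trans (applyUpTo-cong {λ i → coeff (a · p) (N ∸ i)} (suc N) (λ i _ → coeff-· a p (N ∸ i)))
                        (≡⇒≋ (≡.sym (map-applyUpTo (λ i → coeff p (N ∸ i)) (a *_) (suc N))))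

  rev-[] : ∀ N → rev N [] ≋ []
  rev-[] N = applyUpTo-0# (suc N)

  rev-∷ : ∀ m a p → rev (suc m) (a ∷ p) ≋ rev m p +ₚ shift (suc m) (a ∷ [])
  rev-∷ m a p = begin
    applyUpTo f (suc (suc m))
      ≈⟨ ≡⇒≋ (applyUpTo-∷ʳ f (suc m)) ⟨
    applyUpTo f (suc m) ∷ʳ f (suc m)
      ≈⟨ ++≋+ₚ-shift (applyUpTo f (suc m)) (f (suc m) ∷ []) ⟩
    applyUpTo f (suc m) +ₚ shift (length (applyUpTo f (suc m))) (f (suc m) ∷ [])
      ≈⟨ +ₚ-cong (applyUpTo-cong (suc m) f≈) (≡⇒≋ (≡.cong₂ shift (length-applyUpTo f (suc m)) last≡a)) ⟩
    rev m p +ₚ shift (suc m) (a ∷ [])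
      ∎
    where
    open ≋-Reasoning
    f : ℕ → Carrier
    f i = coeff (a ∷ p) (suc m ∸ i)
    last≡a : f (suc m) ∷ [] ≡.≡ a ∷ []
    last≡a = ≡.cong (λ n → coeff (a ∷ p) n ∷ []) (ℕₚ.n∸n≡0 m)
    f≈ : ∀ i → i < suc m → f i ≈ coeff p (m ∸ i)
    f≈ i (s≤s i≤m) = ≡.subst (λ n → coeff (a ∷ p) n ≈ coeff p (m ∸ i)) (≡.sym (ℕₚ.+-∸-assoc 1 i≤m)) refl

  rev-X : ∀ N p → rev (suc N) (X p) ≋ rev N p
  rev-X N p = begin
    rev (suc N) (X p)                ≈⟨ rev-∷ N 0# p ⟩
    rev N p +ₚ shift (suc N) (X [])  ≈⟨ +ₚ-cong (≋-refl {rev N p}) (shift-cong (suc N) X[]≋[]) ⟩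
    rev N p +ₚ shift (suc N) []      ≈⟨ +ₚ-cong (≋-refl {rev N p}) (shift-[] (suc N)) ⟩
    rev N p +ₚ []                    ≈⟨ +ₚ-identityʳ (rev N p) ⟩
    rev N p                          ∎
    where open ≋-Reasoning

  rev-suc : ∀ N q → deg q < suc N → rev (suc N) q ≋ X (rev N q)
  rev-suc N q q<1+N = ∷-cong (vanishes q<1+N (suc N) ℕₚ.≤-refl) ≋-refl

  rev-+-shift : ∀ m n q → deg q < suc n → rev (m ℕ.+ n) q ≋ shift m (rev n q)
  rev-+-shift zero    n q q<1+n = ≋-refl
  rev-+-shift (suc m) n q q<1+n =
    ≋-trans (rev-suc (m ℕ.+ n) q (deg<-mono (s≤s (ℕₚ.m≤n+m n m)) q<1+n)) (X-cong (rev-+-shift m n q q<1+n))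

  rev-monic-scalar-unit : ∀ {e α β s} → IsMonic e β → rev e β ≋ s · α → coeff α 0 * s ≈ 1#
  rev-monic-scalar-unit {e} {α} {β} {s} β-monic β*≋sα = begin
    coeff α 0 * s       ≈⟨ *-comm (coeff α 0) s ⟩
    s * coeff α 0       ≈⟨ coeff-· s α 0 ⟨
    coeff (s · α) 0     ≈⟨ at β*≋sα 0 ⟨
    coeff (rev e β) 0   ≈⟨ leading≈1 β-monic ⟩
    1#                  ∎
    where open ≈-Reasoning

  rev-*ₚ : ∀ m n p q → deg p < suc m → deg q < suc n → rev (m ℕ.+ n) (p *ₚ q) ≋ rev m p *ₚ rev n q
  rev-*ₚ m n [] q p<1+m q<1+n =
    ≋-trans (rev-[] (m ℕ.+ n)) (≋-sym (*ₚ-zeroˡ (rev m []) (rev n q) (rev-[] m)))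
  rev-*ₚ zero n (a ∷ p) q a∷p<1 q<1+n = begin
    rev n ((a ∷ p) *ₚ q)          ≈⟨ rev-cong n (constant-*ₚ q a∷p<1) ⟩
    rev n (a · q)                 ≈⟨ rev-· n a q ⟩
    a · rev n q                   ≈⟨ const-*ₚ a (rev n q) ⟨
    (a ∷ []) *ₚ rev n q           ∎
    where open ≋-Reasoning
  rev-*ₚ (suc m) n (a ∷ p) q a∷p<2+m q<1+n = begin
    rev (suc (m ℕ.+ n)) (a · q +ₚ X (p *ₚ q))
      ≈⟨ rev-+ₚ (suc (m ℕ.+ n)) (a · q) (X (p *ₚ q)) ⟩
    rev (suc m ℕ.+ n) (a · q) +ₚ rev (suc (m ℕ.+ n)) (X (p *ₚ q))
      ≈⟨ +ₚ-cong (rev-· (suc m ℕ.+ n) a q) (rev-X (m ℕ.+ n) (p *ₚ q)) ⟩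
    a · rev (suc m ℕ.+ n) q +ₚ rev (m ℕ.+ n) (p *ₚ q)
      ≈⟨ +ₚ-cong (·-cong refl (rev-+-shift (suc m) n q q<1+n)) (rev-*ₚ m n p q (deg<-tail a∷p<2+m) q<1+n) ⟩
    a · shift (suc m) q* +ₚ rev m p *ₚ q*
      ≈⟨ +ₚ-comm (a · shift (suc m) q*) (rev m p *ₚ q*) ⟩
    rev m p *ₚ q* +ₚ a · shift (suc m) q*
      ≈⟨ +ₚ-cong (≋-refl {rev m p *ₚ q*}) a·shift≋ ⟩
    rev m p *ₚ q* +ₚ shift (suc m) (a ∷ []) *ₚ q*
      ≈⟨ *ₚ-distribʳ (rev m p) (shift (suc m) (a ∷ [])) q* ⟨
    (rev m p +ₚ shift (suc m) (a ∷ [])) *ₚ q*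
      ≈⟨ *ₚ-congˡ q* (rev-∷ m a p) ⟨
    rev (suc m) (a ∷ p) *ₚ q*
      ∎
    where
    open ≋-Reasoning
    q* : Poly
    q* = rev n q
    a·shift≋ : a · shift (suc m) q* ≋ shift (suc m) (a ∷ []) *ₚ q*
    a·shift≋ = ≋-trans (·-shift a (suc m) q*)
                 (≋-sym (≋-trans (shift-*ₚ (suc m) (a ∷ []) q*) (shift-cong (suc m) (const-*ₚ a q*))))

  reverse≋rev : ∀ xs n → length xs ≡.≡ suc n → reverse xs ≋ rev n xs
  reverse≋rev (x ∷ [])     zero    _   = ≋-refl
  reverse≋rev (x ∷ y ∷ ys) (suc n) len = begin
    reverse (x ∷ xs)                                ≈⟨ ≡⇒≋ (unfold-reverse x xs) ⟩
    reverse xs ∷ʳ x                                 ≈⟨ ++≋+ₚ-shift (reverse xs) (x ∷ []) ⟩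
    reverse xs +ₚ shift (length (reverse xs)) (x ∷ [])
      ≈⟨ +ₚ-cong (reverse≋rev xs n len′) (≡⇒≋ (≡.cong (λ l → shift l (x ∷ [])) (≡.trans (length-reverse xs) len′))) ⟩
    rev n xs +ₚ shift (suc n) (x ∷ [])              ≈⟨ rev-∷ n x xs ⟨
    rev (suc n) (x ∷ xs)                            ∎
    where
    open ≋-Reasoning
    xs : Poly
    xs = y ∷ ys
    len′ : length xs ≡.≡ suc n
    len′ = ℕₚ.suc-injective len

  reciprocal≋rev : ∀ {k} (a : Vec Carrier k) → reciprocal a ≋ rev k (monic a)
  reciprocal≋rev {k} a = reverse≋rev (monic a) k (length-monic a)
    where
    length-monic : ∀ {k} (a : Vec Carrier k) → length (monic a) ≡.≡ suc k
    length-monic []ᵥ      = ≡.refl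
    length-monic (x ∷ᵥ a) = ≡.cong suc (length-monic a)

module Factorisation {c ℓ : Level} (F : FiniteField c ℓ) where
  open FiniteField F
  open Polynomials F renaming (_+ₚ_ to infixl 6 _+ₚ_; _*ₚ_ to infixl 7 _*ₚ_)
  open PolynomialRing F
  open Degree F
  open Reversal F
  open CommutativeRingLemmas polynomialRing using (coprime-divisor)
  open NaturalCoefficients (CommutativeRing.commutativeSemiring polynomialRing) using (solve; _:*_; _:=_)

  record Gcd (a b : Poly) : Set (c ⊔ ℓ) where
    field
      {degree} : ℕ
      gcd a′ b′ u v : Poly
      gcd-monic : IsMonic degree gcd
      a≋gcd*a′ : a ≋ gcd *ₚ a′
      b≋gcd*b′ : b ≋ gcd *ₚ b′
      bezout : u *ₚ a′ +ₚ v *ₚ b′ ≋ 1ₚ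

  record CoprimeFactorisation (k : ℕ) (a b : Poly) : Set (c ⊔ ℓ) where
    field
      {d e} : ℕ
      d+e≡k : d ℕ.+ e ≡.≡ k
      g α β u v : Poly
      g-monic : IsMonic d g
      α-monic : IsMonic e α
      β-monic : IsMonic e β
      a≋gα : a ≋ g *ₚ α
      b≋gβ : b ≋ g *ₚ β
      bezout : u *ₚ α +ₚ v *ₚ β ≋ 1ₚ

  Gcd⇒CoprimeFactorisation : ∀ {k a b} → IsMonic k a → IsMonic k b → Gcd a b → CoprimeFactorisation k a b
  Gcd⇒CoprimeFactorisation {k} a-monic b-monic G = record
    { d+e≡k = d+e≡k
    ; g = gcd ; α = a′ ; β = b′ ; u = u ; v = v
    ; g-monic = gcd-monic
    ; α-monic = monic-cofactor (≡.subst (λ n → IsMonic n _) (≡.sym d+e≡k) a-monic) gcd-monic a≋gcd*a′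
    ; β-monic = monic-cofactor (≡.subst (λ n → IsMonic n _) (≡.sym d+e≡k) b-monic) gcd-monic b≋gcd*b′
    ; a≋gα = a≋gcd*a′
    ; b≋gβ = b≋gcd*b′
    ; bezout = bezout }
    where
    open Gcd G
    d+e≡k : degree ℕ.+ (k ∸ degree) ≡.≡ k
    d+e≡k = ℕₚ.m+[n∸m]≡n (monic-divisor-degree a-monic gcd-monic a≋gcd*a′)

  module _ {k a b} (D : CoprimeFactorisation k a b) where
    open CoprimeFactorisation D

    rev-factor : ∀ {x y} → IsMonic e y → x ≋ g *ₚ y → rev k x ≋ rev d g *ₚ rev e y
    rev-factor {x} {y} y-monic x≋gy = begin
      rev k x                   ≈⟨ rev-cong k x≋gy ⟩
      rev k (g *ₚ y)            ≈⟨ ≡⇒≋ (≡.cong (λ n → rev n (g *ₚ y)) (≡.sym d+e≡k)) ⟩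
      rev (d ℕ.+ e) (g *ₚ y)    ≈⟨ rev-*ₚ d e g y (deg< g-monic) (deg< y-monic) ⟩
      rev d g *ₚ rev e y        ∎
      where open ≋-Reasoning

    cofactor-equation : rev k a *ₚ a ≋ rev k b *ₚ b → rev e α *ₚ α ≋ rev e β *ₚ β
    cofactor-equation a*a≋b*b =
      -- the constant term of rev d g is the leading coefficient of g
      const-one-*ₚ-cancelˡ {rev d g} (leading≈1 g-monic) (monic-*ₚ-cancelˡ g-monic (begin
        g *ₚ (rev d g *ₚ (rev e α *ₚ α))   ≈⟨ rearrange g (rev d g) (rev e α) α ⟩
        (rev d g *ₚ rev e α) *ₚ (g *ₚ α)   ≈⟨ *ₚ-cong (rev-factor α-monic a≋gα) a≋gα ⟨
        rev k a *ₚ a                       ≈⟨ a*a≋b*b ⟩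
        rev k b *ₚ b                       ≈⟨ *ₚ-cong (rev-factor β-monic b≋gβ) b≋gβ ⟩
        (rev d g *ₚ rev e β) *ₚ (g *ₚ β)   ≈⟨ rearrange g (rev d g) (rev e β) β ⟨
        g *ₚ (rev d g *ₚ (rev e β *ₚ β))   ∎))
      where
      open ≋-Reasoning
      rearrange : ∀ w x y z → w *ₚ (x *ₚ (y *ₚ z)) ≋ (x *ₚ y) *ₚ (w *ₚ z)
      rearrange = solve 4 (λ w x y z → w :* (x :* (y :* z)) := (x :* y) :* (w :* z)) ≋-refl

    rev-cofactor-scalar : rev k a *ₚ a ≋ rev k b *ₚ b → Σ Carrier λ s → rev e β ≋ s · α
    rev-cofactor-scalar a*a≋b*b =
      coeff w 0 , scalar-multiple-of-monic w α-monic (deg-rev e β)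
                    (coprime-divisor {α} {β} {u} {v} {rev e β} {rev e α} bezout (≋-sym (cofactor-equation a*a≋b*b)))
      where
      w : Poly
      w = u *ₚ rev e β +ₚ v *ₚ rev e α

  solution-determined-by-gcd : ∀ {k a a′ b} (D : CoprimeFactorisation k a b) (D′ : CoprimeFactorisation k a′ b) →
    rev k a *ₚ a ≋ rev k b *ₚ b → rev k a′ *ₚ a′ ≋ rev k b *ₚ b →
    CoprimeFactorisation.g D ≋ CoprimeFactorisation.g D′ → a ≋ a′
  solution-determined-by-gcd {k} {a} {a′} {b} D D′ a*a≋b*b a′*a′≋b*b g≋g′ = begin
    a          ≈⟨ a≋gα ⟩
    g *ₚ α     ≈⟨ *ₚ-cong g≋g′ α≋α′ ⟩
    g′ *ₚ α′   ≈⟨ a′≋g′α′ ⟨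
    a′         ∎
    where
    open CoprimeFactorisation D
    open CoprimeFactorisation D′ using () renaming
      ( e to e′; g to g′; α to α′; β to β′
      ; α-monic to α′-monic; β-monic to β′-monic; a≋gα to a′≋g′α′; b≋gβ to b≋g′β′ )
    open ≋-Reasoning

    β≋β′ : β ≋ β′
    β≋β′ = monic-*ₚ-cancelˡ g-monic (begin
      g *ₚ β    ≈⟨ b≋gβ ⟨
      b         ≈⟨ b≋g′β′ ⟩
      g′ *ₚ β′  ≈⟨ *ₚ-congˡ β′ g≋g′ ⟨
      g *ₚ β′   ∎)

    e≡e′ : e ≡.≡ e′
    e≡e′ = IsMonic-degree-unique β-monic (IsMonic-cong (≋-sym β≋β′) β′-monic)

    s : Carrier
    s = proj₁ (rev-cofactor-scalar D a*a≋b*b)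
    s′ : Carrier
    s′ = proj₁ (rev-cofactor-scalar D′ a′*a′≋b*b)
    β*≋sα : rev e β ≋ s · α
    β*≋sα = proj₂ (rev-cofactor-scalar D a*a≋b*b)

    sα≋s′α′ : s · α ≋ s′ · α′
    sα≋s′α′ = begin
      s · α       ≈⟨ β*≋sα ⟨
      rev e β     ≈⟨ ≡.subst (λ n → rev e β ≋ rev n β′) e≡e′ (rev-cong e β≋β′) ⟩
      rev e′ β′   ≈⟨ proj₂ (rev-cofactor-scalar D′ a′*a′≋b*b) ⟩
      s′ · α′     ∎

    s≈s′ : s ≈ s′
    s≈s′ = monic-scalar-unique α-monic (≡.subst (λ n → IsMonic n α′) (≡.sym e≡e′) α′-monic) sα≋s′α′

    α≋α′ : α ≋ α′
    α≋α′ = ·-cancel-unit (rev-monic-scalar-unit β-monic β*≋sα)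
             (≋-trans sα≋s′α′ (·-cong (sym s≈s′) (≋-refl {α′})))

DecidableZero : ∀ {c ℓ} → FiniteField c ℓ → Set (c ⊔ ℓ)
DecidableZero F = ∀ x → Dec (x ≈ 0#)
  where open FiniteField F

module Euclid {c ℓ : Level} (F : FiniteField c ℓ) (≈0? : DecidableZero F) where
  open FiniteField F
  open Polynomials F renaming (_+ₚ_ to infixl 6 _+ₚ_; _*ₚ_ to infixl 7 _*ₚ_)
  open PolynomialRing F
  open Degree F
  open Factorisation F
  open CommutativeRingLemmas polynomialRing using (bezout-step)
  open NaturalCoefficients (CommutativeRing.commutativeSemiring polynomialRing) using (solve; _:+_; _:*_; _:=_)

  leading-term : ∀ {n p} → deg p < n → p ≋ [] ⊎ Σ ℕ λ d → d < n × ¬ coeff p d ≈ 0# × deg p < suc d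
  leading-term {zero}      p<0   = inj₁ (deg<0⇒≋[] p<0)
  leading-term {suc n} {p} p<1+n with ≈0? (coeff p n)
  ... | no  pₙ≉0 = inj₂ (n , ℕₚ.≤-refl , pₙ≉0 , p<1+n)
  ... | yes pₙ≈0 with leading-term (deg<-lower p<1+n pₙ≈0)
  ...   | inj₁ p≋[]                     = inj₁ p≋[]
  ...   | inj₂ (d , d<n , p_d≉0 , p<1+d) = inj₂ (d , ℕₚ.m<n⇒m<1+n d<n , p_d≉0 , p<1+d)

  monic-associate : ∀ {d p} → deg p < suc d → ¬ coeff p d ≈ 0# →
    Σ Carrier λ a → Σ Carrier λ a⁻¹ → a * a⁻¹ ≈ 1# × Σ Poly λ ρ → IsMonic d ρ × p ≋ a · ρ
  monic-associate {d} {p} p<1+d p_d≉0 = a , a⁻¹ , aa⁻¹≈1 , a⁻¹ · p , ρ-monic , p≋aρ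
    where
    a : Carrier
    a = coeff p d
    a⁻¹ : Carrier
    a⁻¹ = proj₁ (inverse a p_d≉0)
    aa⁻¹≈1 : a * a⁻¹ ≈ 1#
    aa⁻¹≈1 = proj₂ (inverse a p_d≉0)
    ρ-monic : IsMonic d (a⁻¹ · p)
    ρ-monic = record
      { deg< = deg<-· a⁻¹ p<1+d
      ; leading≈1 = trans (coeff-· a⁻¹ p d) (trans (*-comm a⁻¹ a) aa⁻¹≈1) }
    p≋aρ : p ≋ a · (a⁻¹ · p)
    p≋aρ = ≋-sym (≋-trans (·-·-assoc a a⁻¹ p) (·-identity p aa⁻¹≈1))

  gcd-step : ∀ {A B ρ} q a a⁻¹ → a * a⁻¹ ≈ 1# → B ≋ q *ₚ A +ₚ a · ρ → Gcd ρ A → Gcd A B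
  gcd-step {A} {B} {ρ} q a a⁻¹ aa⁻¹≈1 B≋qA+aρ G = record
    { gcd = gcd
    ; a′ = A′
    ; b′ = q *ₚ A′ +ₚ [a] *ₚ ρ′
    ; u = v +ₚ -ₚ ([a⁻¹] *ₚ u *ₚ q)
    ; v = [a⁻¹] *ₚ u
    ; gcd-monic = gcd-monic
    ; a≋gcd*a′ = A≋gA′
    ; b≋gcd*b′ = begin
        B
          ≈⟨ B≋qA+aρ ⟩
        q *ₚ A +ₚ a · ρ
          ≈⟨ +ₚ-cong (*ₚ-cong (≋-refl {q}) A≋gA′) (≋-trans (·-cong refl ρ≋gρ′) (≋-sym (const-*ₚ a (gcd *ₚ ρ′)))) ⟩
        q *ₚ (gcd *ₚ A′) +ₚ [a] *ₚ (gcd *ₚ ρ′)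
          ≈⟨ factor-gcd q gcd A′ [a] ρ′ ⟩
        gcd *ₚ (q *ₚ A′ +ₚ [a] *ₚ ρ′)
          ∎
    ; bezout = bezout-step {ρ′} {A′} {u} {v} {q} {[a]} {[a⁻¹]} bezout [a][a⁻¹]≋1 }
    where
    open Gcd G renaming (a′ to ρ′; b′ to A′; a≋gcd*a′ to ρ≋gρ′; b≋gcd*b′ to A≋gA′)
    open ≋-Reasoning
    [a] : Poly
    [a] = a ∷ []
    [a⁻¹] : Poly
    [a⁻¹] = a⁻¹ ∷ []
    [a][a⁻¹]≋1 : [a] *ₚ [a⁻¹] ≋ 1ₚ
    [a][a⁻¹]≋1 = ≋-trans (const-*ₚ a [a⁻¹]) (∷-cong aa⁻¹≈1 ≋-refl)
    factor-gcd : ∀ q g x a y → q *ₚ (g *ₚ x) +ₚ a *ₚ (g *ₚ y) ≋ g *ₚ (q *ₚ x +ₚ a *ₚ y)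
    factor-gcd = solve 5 (λ q g x a y → q :* (g :* x) :+ a :* (g :* y) := g :* (q :* x :+ a :* y)) ≋-refl

  gcd : ∀ {m A} → Acc _<_ m → IsMonic m A → ∀ B → Gcd A B
  gcd {m} {A} (acc rec) A-monic B with divMod-monic A-monic B
  ... | q , r , B≋qA+r , r<m with leading-term r<m
  ...   | inj₁ r≋[] = record
    { gcd = A ; a′ = 1ₚ ; b′ = q ; u = 1ₚ ; v = []
    ; gcd-monic = A-monic
    ; a≋gcd*a′ = ≋-sym (*ₚ-identityʳ A)
    ; b≋gcd*b′ = ≋-trans B≋qA+r
                   (≋-trans (+ₚ-cong (≋-refl {q *ₚ A}) r≋[]) (≋-trans (+ₚ-identityʳ (q *ₚ A)) (*ₚ-comm q A)))
    ; bezout = ≋-trans (+ₚ-identityʳ (1ₚ *ₚ 1ₚ)) (*ₚ-identityˡ 1ₚ) }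
  ...   | inj₂ (d , d<m , r_d≉0 , r<1+d) with monic-associate r<1+d r_d≉0
  ...     | a , a⁻¹ , aa⁻¹≈1 , ρ , ρ-monic , r≋aρ =
    gcd-step q a a⁻¹ aa⁻¹≈1 (≋-trans B≋qA+r (+ₚ-cong (≋-refl {q *ₚ A}) r≋aρ)) (gcd (rec d<m) ρ-monic A)

module Counting {c ℓ : Level} (F : FiniteField c ℓ) where
  open FiniteField F
  open Polynomials F renaming (_+ₚ_ to infixl 6 _+ₚ_; _*ₚ_ to infixl 7 _*ₚ_)
  open PolynomialRing F
  open Degree F
  open Reversal F
  open Factorisation F

  ¬¬-decidable-zero : ¬ ¬ DecidableZero F
  ¬¬-decidable-zero = ¬¬-map decide (¬¬-all-decidable (_≈ 0#) elements)
    where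
    decide : All (λ e → Dec (e ≈ 0#)) elements → DecidableZero F
    decide elements-decidable x with lookupAny elements-decidable (complete x)
    ... | e≈0? , x≈e = map′ (trans x≈e) (trans (sym x≈e)) e≈0?

  module _ (≈0? : DecidableZero F) where
    open Euclid F ≈0?

    coprimeFactorisation : ∀ {k} (a b : Vec Carrier k) → CoprimeFactorisation k (monic a) (monic b)
    coprimeFactorisation {k} a b = Gcd⇒CoprimeFactorisation (monic-isMonic a) (monic-isMonic b)
      (gcd (<-wellFounded k) (monic-isMonic a) (monic b))

    solutions≤divisors : ∀ k (b : Vec Carrier k) (As : List (Vec Carrier k)) →
      AllPairs (λ a a′ → ¬ (monic a ≈ₚ monic a′)) As →
      All (λ a → (reciprocal a *ₚ monic a) ≈ₚ (reciprocal b *ₚ monic b)) As →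
      (Ds : List Monic) → (∀ d → poly d ∣ₚ monic b → Any (d ≈ₘ_) Ds) →
      length As ≤ length Ds
    solutions≤divisors k b As As-distinct As-solutions Ds Ds-complete =
      pigeonhole (length Ds) GcdAt same-gcd⇒equal As As-distinct (All.map gcd-index As-solutions)
      where
      Solution : Vec Carrier k → Set ℓ
      Solution a = rev k (monic a) *ₚ monic a ≋ rev k (monic b) *ₚ monic b

      GcdAt : Vec Carrier k → Fin (length Ds) → Set (c ⊔ ℓ)
      GcdAt a i = Solution a × Σ (CoprimeFactorisation k (monic a) (monic b))
                                 λ D → CoprimeFactorisation.g D ≋ poly (lookup Ds i)

      same-gcd⇒equal : ∀ {a a′ i} → GcdAt a i → GcdAt a′ i → ¬ ¬ (monic a ≈ₚ monic a′)
      same-gcd⇒equal (sol , D , g≋Dᵢ) (sol′ , D′ , g′≋Dᵢ) a≉a′ =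
        a≉a′ (at (solution-determined-by-gcd D D′ sol sol′ (≋-trans g≋Dᵢ (≋-sym g′≋Dᵢ))))

      gcd-index : ∀ {a} → (reciprocal a *ₚ monic a) ≈ₚ (reciprocal b *ₚ monic b) → ∃ (GcdAt a)
      gcd-index {a} a*a≈b*b = Any.index g∈Ds , solution , D , ≋-trans g≋g-vec ⟨ lookup-index g∈Ds ⟩
        where
        D : CoprimeFactorisation k (monic a) (monic b)
        D = coprimeFactorisation a b
        open CoprimeFactorisation D
        g-vec : Vec Carrier d
        g-vec = proj₁ (IsMonic⇒monic g-monic)
        g≋g-vec : g ≋ monic g-vec
        g≋g-vec = proj₂ (IsMonic⇒monic g-monic)
        solution : Solution a
        solution = ≋-trans (*ₚ-congˡ (monic a) (≋-sym (reciprocal≋rev a)))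
                     (≋-trans ⟨ a*a≈b*b ⟩ (*ₚ-congˡ (monic b) (reciprocal≋rev b)))
        g∈Ds : Any ((d , g-vec) ≈ₘ_) Ds
        g∈Ds = Ds-complete (d , g-vec) (β , at (≋-sym (≋-trans b≋gβ (*ₚ-congˡ β g≋g-vec))))

lemma4p2 : {c ℓ : Level} (F : FiniteField c ℓ) →
    let open FiniteField F in
    let open Polynomials F in
    (k : ℕ) (b : Vec Carrier k) →
    -- As : a duplicate-free list of a ∈ M(k) with a* a = b* b
    (As : List (Vec Carrier k)) →
    AllPairs (λ a a′ → ¬ (monic a ≈ₚ monic a′)) As →
    All (λ a → (reciprocal a *ₚ monic a) ≈ₚ (reciprocal b *ₚ monic b)) As →
    -- Ds : a duplicate-free complete list of the monic divisors of b,
    -- so length Ds = τ(b)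
    (Ds : List Monic) →
    AllPairs (λ d d′ → ¬ (d ≈ₘ d′)) Ds →
    All (λ d → poly d ∣ₚ monic b) Ds →
    (∀ d → poly d ∣ₚ monic b → Any (d ≈ₘ_) Ds) →
    length As ≤ length Ds
-- An upper bound needs only the completeness of Ds.
lemma4p2 F k b As As-distinct As-solutions Ds _ _ Ds-complete =
  decidable-stable (length As ≤? length Ds) λ As≰Ds →
    ¬¬-decidable-zero (λ ≈0? → As≰Ds (solutions≤divisors ≈0? k b As As-distinct As-solutions Ds Ds-complete))
  where open Counting F
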